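{- For every meadow term $t$ over the signature $(0,1,+,\cdot,-,{}^{ -1})$ with variables in a set $X$ there exist polynomials $s_0,t_0,\dots,s_n,t_n$ (terms over $(0,1,+,\cdot,-)$ with variables in $X$) such that \[\mathrm{Md}\vdash t=\frac{s_0}{t_0}+\dots+\frac{s_n}{t_n}.\]
   Context: $\mathrm{Md}$ is the set of equational axioms for meadows: the axioms of commutative rings with unit ($(x+y)+z=x+(y+z)$, $x+y=y+x$, $x+0=x$, $x+(-x)=0$, $(x\cdot y)\cdot z=x\cdot(y\cdot z)$, $x\cdot y=y\cdot x$, $1\cdot x=x$, $x\cdot(y+z)=x\cdot y+x\cdot z$) together with $(x^{ -1})^{ -1}=x$ and $x\cdot(x\cdot x^{ -1})=x$. $\mathrm{Md}\vdash$ denotes derivability in equational logic. $s/t$ abbreviates $s\cdot t^{ -1}$. -}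

module Defs where

open import Data.List using (List; []; _∷_; foldl)
open import Data.Product using (Σ; _×_; _,_; proj₁; proj₂)

data Term (X : Set) : Set where
  var  : X → Term X
  𝟎 𝟏  : Term X
  _⊕_  : Term X → Term X → Term X
  _⊗_  : Term X → Term X → Term X
  ⊖_   : Term X → Term X
  _⁻¹  : Term X → Term X

infixl 6 _⊕_
infixl 7 _⊗_
infix 8 ⊖_
infix 9 _⁻¹

data IsPoly {X : Set} : Term X → Set where
  var : ∀ x → IsPoly (var x)
  𝟎   : IsPoly 𝟎
  𝟏   : IsPoly 𝟏
  _⊕_ : ∀ {s t} → IsPoly s → IsPoly t → IsPoly (s ⊕ t)
  _⊗_ : ∀ {s t} → IsPoly s → IsPoly t → IsPoly (s ⊗ t)
  ⊖_  : ∀ {t} → IsPoly t → IsPoly (⊖ t)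

_⊘_ : {X : Set} → Term X → Term X → Term X
s ⊘ t = s ⊗ (t ⁻¹)

-- Md ⊢ s = t : equational logic derivability from the meadow axioms.
-- Axiom schemes are given with arbitrary terms (= all substitution instances).
infix 4 Md⊢_≈_
data Md⊢_≈_ {X : Set} : Term X → Term X → Set where
  +-assoc : ∀ x y z → Md⊢ (x ⊕ y) ⊕ z ≈ x ⊕ (y ⊕ z)
  +-comm  : ∀ x y → Md⊢ x ⊕ y ≈ y ⊕ x
  +-idʳ   : ∀ x → Md⊢ x ⊕ 𝟎 ≈ x
  +-invʳ  : ∀ x → Md⊢ x ⊕ (⊖ x) ≈ 𝟎
  ·-assoc : ∀ x y z → Md⊢ (x ⊗ y) ⊗ z ≈ x ⊗ (y ⊗ z)
  ·-comm  : ∀ x y → Md⊢ x ⊗ y ≈ y ⊗ x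
  ·-idˡ   : ∀ x → Md⊢ 𝟏 ⊗ x ≈ x
  distrib : ∀ x y z → Md⊢ x ⊗ (y ⊕ z) ≈ x ⊗ y ⊕ x ⊗ z
  inv-inv : ∀ x → Md⊢ (x ⁻¹) ⁻¹ ≈ x
  ril     : ∀ x → Md⊢ x ⊗ (x ⊗ x ⁻¹) ≈ x
  refl  : ∀ {x} → Md⊢ x ≈ x
  sym   : ∀ {x y} → Md⊢ x ≈ y → Md⊢ y ≈ x
  trans : ∀ {x y z} → Md⊢ x ≈ y → Md⊢ y ≈ z → Md⊢ x ≈ z
  ⊕-cong : ∀ {x x' y y'} → Md⊢ x ≈ x' → Md⊢ y ≈ y' → Md⊢ x ⊕ y ≈ x' ⊕ y'
  ⊗-cong : ∀ {x x' y y'} → Md⊢ x ≈ x' → Md⊢ y ≈ y' → Md⊢ x ⊗ y ≈ x' ⊗ y'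
  ⊖-cong : ∀ {x x'} → Md⊢ x ≈ x' → Md⊢ ⊖ x ≈ ⊖ x'
  ⁻¹-cong : ∀ {x x'} → Md⊢ x ≈ x' → Md⊢ x ⁻¹ ≈ x' ⁻¹

sumFracs : {X : Set} → Term X × Term X → List (Term X × Term X) → Term X
sumFracs (s , t) ps = foldl (λ acc p → acc ⊕ (proj₁ p ⊘ proj₂ p)) (s ⊘ t) ps

data AllPolyPairs {X : Set} : List (Term X × Term X) → Set where
  []  : AllPolyPairs []
  _∷_ : ∀ {s t ps} → IsPoly s × IsPoly t → AllPolyPairs ps → AllPolyPairs ((s , t) ∷ ps)

module Submission where

-- A term is Md-equal to a binary decision tree whose inner nodes branch on a polynomial r,
-- node r a b standing for  (r/r)·a + (1 - r/r)·b,  and whose leaves are fractions p/q of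
-- polynomials.  Such trees are closed under the operations: −, · and + are computed leafwise
-- after grafting one tree onto the leaves of the other, and ⁻¹ acts leafwise because r/r and
-- 1 - r/r are orthogonal idempotents and inversion distributes over orthogonal sums.  A tree
-- is finally flattened into a sum of fractions using (r/r)·(p/q) = (r p)/(r q).

open import Algebra.Bundles using (CommutativeRing)
open import Algebra.Solver.Ring.AlmostCommutativeRing
  using (fromCommutativeRing; _-Raw-AlmostCommutative⟶_)
open import Algebra.Structures using (IsCommutativeRing)
open import Data.Integer as ℤ using (ℤ; +_; -[1+_]; _⊖_; _◃_; sign; ∣_∣)
import Data.Integer.Properties as ℤ
open import Data.List using (List; []; _∷_; _++_; map; foldl)
open import Data.Maybe using (Maybe; just; nothing)
open import Data.Nat as ℕ using (zero; suc)
import Data.Nat.Properties as ℕ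
open import Data.Product using (Σ; _×_; _,_; proj₁; proj₂)
open import Data.Sign as Sign using (Sign)
open import Level using (0ℓ)
open import Relation.Nullary using (yes; no)
import Relation.Binary.PropositionalEquality as ≡

-- The integer analogue of Algebra.Solver.Ring.NaturalCoefficients.
module IntegerCoefficients {c ℓ} (R : CommutativeRing c ℓ) where
  open CommutativeRing R
  open import Algebra.Properties.Ring ring using (-‿involutive; -0#≈0#; -1*x≈-x; -‿+-comm)
  open import Algebra.Properties.Semiring.Mult.TCOptimised semiring
    using (1+×; ×-homo-+; ×1-homo-*) renaming (_×_ to _·_)
  open import Relation.Binary.Reasoning.Setoid setoid

  ℤ⟦_⟧ : ℤ → Carrier
  ℤ⟦ + n ⟧ = n · 1#
  ℤ⟦ -[1+ n ] ⟧ = - (suc n · 1#)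

  Sign⟦_⟧ : Sign → Carrier
  Sign⟦ Sign.+ ⟧ = 1#
  Sign⟦ Sign.- ⟧ = - 1#

  ℤ⟦⟧-homo-neg : ∀ i → ℤ⟦ ℤ.- i ⟧ ≈ - ℤ⟦ i ⟧
  ℤ⟦⟧-homo-neg -[1+ n ] = sym (-‿involutive _)
  ℤ⟦⟧-homo-neg (+ zero) = sym -0#≈0#
  ℤ⟦⟧-homo-neg (+ suc n) = refl

  1+x-[1+y]≈x-y : ∀ x y → (1# + x) + - (1# + y) ≈ x + - y
  1+x-[1+y]≈x-y x y = begin
    (1# + x) + - (1# + y)    ≈⟨ +-congˡ (-‿+-comm 1# y) ⟨
    (1# + x) + (- 1# + - y)  ≈⟨ +-assoc 1# x _ ⟩
    1# + (x + (- 1# + - y))  ≈⟨ +-congˡ (x∙yz≈y∙xz x (- 1#) (- y)) ⟩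
    1# + (- 1# + (x + - y))  ≈⟨ +-assoc 1# (- 1#) _ ⟨
    (1# + - 1#) + (x + - y)  ≈⟨ +-congʳ (-‿inverseʳ 1#) ⟩
    0# + (x + - y)           ≈⟨ +-identityˡ _ ⟩
    x + - y                  ∎
    where open import Algebra.Properties.CommutativeSemigroup +-commutativeSemigroup using (x∙yz≈y∙xz)

  ℤ⟦⟧-homo-⊖ : ∀ m n → ℤ⟦ m ⊖ n ⟧ ≈ m · 1# + - (n · 1#)
  ℤ⟦⟧-homo-⊖ m zero = sym (trans (+-congˡ -0#≈0#) (+-identityʳ _))
  ℤ⟦⟧-homo-⊖ zero (suc n) = sym (+-identityˡ _)
  ℤ⟦⟧-homo-⊖ (suc m) (suc n) = begin
    ℤ⟦ suc m ⊖ suc n ⟧                  ≡⟨ ≡.cong ℤ⟦_⟧ (ℤ.[1+m]⊖[1+n]≡m⊖n m n) ⟩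
    ℤ⟦ m ⊖ n ⟧                          ≈⟨ ℤ⟦⟧-homo-⊖ m n ⟩
    m · 1# + - (n · 1#)                 ≈⟨ 1+x-[1+y]≈x-y _ _ ⟨
    (1# + m · 1#) + - (1# + n · 1#)     ≈⟨ +-cong (1+× m 1#) (-‿cong (1+× n 1#)) ⟨
    suc m · 1# + - (suc n · 1#)         ∎

  ℤ⟦⟧-homo-+ : ∀ i j → ℤ⟦ i ℤ.+ j ⟧ ≈ ℤ⟦ i ⟧ + ℤ⟦ j ⟧
  ℤ⟦⟧-homo-+ -[1+ m ] -[1+ n ] = begin
    - (suc (suc (m ℕ.+ n)) · 1#)        ≡⟨ ≡.cong (λ k → - (suc k · 1#)) (ℕ.+-suc m n) ⟨
    - ((suc m ℕ.+ suc n) · 1#)          ≈⟨ -‿cong (×-homo-+ 1# (suc m) (suc n)) ⟩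
    - (suc m · 1# + suc n · 1#)         ≈⟨ -‿+-comm _ _ ⟨
    - (suc m · 1#) + - (suc n · 1#)     ∎
  ℤ⟦⟧-homo-+ -[1+ m ] (+ n) = trans (ℤ⟦⟧-homo-⊖ n (suc m)) (+-comm _ _)
  ℤ⟦⟧-homo-+ (+ m) -[1+ n ] = ℤ⟦⟧-homo-⊖ m (suc n)
  ℤ⟦⟧-homo-+ (+ m) (+ n) = ×-homo-+ 1# m n

  ℤ⟦⟧-homo-◃ : ∀ s n → ℤ⟦ s ◃ n ⟧ ≈ Sign⟦ s ⟧ * (n · 1#)
  ℤ⟦⟧-homo-◃ Sign.+ n = trans (reflexive (≡.cong ℤ⟦_⟧ (ℤ.+◃n≡+n n))) (sym (*-identityˡ _))
  ℤ⟦⟧-homo-◃ Sign.- n = begin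
    ℤ⟦ Sign.- ◃ n ⟧       ≡⟨ ≡.cong ℤ⟦_⟧ (ℤ.-◃n≡-n n) ⟩
    ℤ⟦ ℤ.- (+ n) ⟧        ≈⟨ ℤ⟦⟧-homo-neg (+ n) ⟩
    - (n · 1#)            ≈⟨ -1*x≈-x _ ⟨
    - 1# * (n · 1#)       ∎

  Sign⟦⟧-homo-* : ∀ s t → Sign⟦ s Sign.* t ⟧ ≈ Sign⟦ s ⟧ * Sign⟦ t ⟧
  Sign⟦⟧-homo-* Sign.+ t = sym (*-identityˡ _)
  Sign⟦⟧-homo-* Sign.- Sign.+ = sym (*-identityʳ _)
  Sign⟦⟧-homo-* Sign.- Sign.- = sym (trans (-1*x≈-x _) (-‿involutive _))

  ℤ⟦⟧≈sign*abs : ∀ i → ℤ⟦ i ⟧ ≈ Sign⟦ sign i ⟧ * (∣ i ∣ · 1#)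
  ℤ⟦⟧≈sign*abs i = trans (reflexive (≡.cong ℤ⟦_⟧ (≡.sym (ℤ.signᵢ◃∣i∣≡i i)))) (ℤ⟦⟧-homo-◃ (sign i) ∣ i ∣)

  ℤ⟦⟧-homo-* : ∀ i j → ℤ⟦ i ℤ.* j ⟧ ≈ ℤ⟦ i ⟧ * ℤ⟦ j ⟧
  ℤ⟦⟧-homo-* i j = begin
    ℤ⟦ (sign i Sign.* sign j) ◃ (∣ i ∣ ℕ.* ∣ j ∣) ⟧
      ≈⟨ ℤ⟦⟧-homo-◃ (sign i Sign.* sign j) (∣ i ∣ ℕ.* ∣ j ∣) ⟩
    Sign⟦ sign i Sign.* sign j ⟧ * ((∣ i ∣ ℕ.* ∣ j ∣) · 1#)
      ≈⟨ *-cong (Sign⟦⟧-homo-* (sign i) (sign j)) (×1-homo-* ∣ i ∣ ∣ j ∣) ⟩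
    (Sign⟦ sign i ⟧ * Sign⟦ sign j ⟧) * (∣ i ∣ · 1# * ∣ j ∣ · 1#)
      ≈⟨ interchange _ _ _ _ ⟩
    (Sign⟦ sign i ⟧ * ∣ i ∣ · 1#) * (Sign⟦ sign j ⟧ * ∣ j ∣ · 1#)
      ≈⟨ *-cong (ℤ⟦⟧≈sign*abs i) (ℤ⟦⟧≈sign*abs j) ⟨
    ℤ⟦ i ⟧ * ℤ⟦ j ⟧ ∎
    where open import Algebra.Properties.CommutativeSemigroup *-commutativeSemigroup using (interchange)

  ℤ⟦⟧-homomorphism : ℤ.+-*-rawRing -Raw-AlmostCommutative⟶ fromCommutativeRing R
  ℤ⟦⟧-homomorphism = record
    { ⟦_⟧ = ℤ⟦_⟧ ; +-homo = ℤ⟦⟧-homo-+ ; *-homo = ℤ⟦⟧-homo-* ; -‿homo = ℤ⟦⟧-homo-neg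
    ; 0-homo = refl ; 1-homo = refl }

  ℤ⟦⟧-≟ : ∀ i j → Maybe (ℤ⟦ i ⟧ ≈ ℤ⟦ j ⟧)
  ℤ⟦⟧-≟ i j with i ℤ.≟ j
  ... | yes ≡.refl = just refl
  ... | no _       = nothing

  open import Algebra.Solver.Ring ℤ.+-*-rawRing (fromCommutativeRing R) ℤ⟦⟧-homomorphism ℤ⟦⟧-≟ public

module Conditional {c ℓ} (R : CommutativeRing c ℓ) where
  open CommutativeRing R
  open IntegerCoefficients R using (solve; _:=_; _:+_; _:*_; :-_; _:-_; con; Polynomial)
  open import Relation.Binary.Reasoning.Setoid setoid

  private
    :0 :1 : ∀ {n} → Polynomial n
    :0 = con (+ 0)
    :1 = con (+ 1)

  Idempotent : Carrier → Set ℓ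
  Idempotent e = e * e ≈ e

  cond : Carrier → Carrier → Carrier → Carrier
  cond e x y = e * x + (1# - e) * y

  cond-cong : ∀ e {x x' y y'} → x ≈ x' → y ≈ y' → cond e x y ≈ cond e x' y'
  cond-cong e x≈x' y≈y' = +-cong (*-congˡ x≈x') (*-congˡ y≈y')

  +-distribʳ-cond : ∀ e x y z → cond e x y + z ≈ cond e (x + z) (y + z)
  +-distribʳ-cond = solve 4 (λ e x y z →
    (e :* x :+ (:1 :- e) :* y) :+ z := e :* (x :+ z) :+ (:1 :- e) :* (y :+ z)) refl

  +-distribˡ-cond : ∀ e x y z → z + cond e x y ≈ cond e (z + x) (z + y)
  +-distribˡ-cond = solve 4 (λ e x y z →
    z :+ (e :* x :+ (:1 :- e) :* y) := e :* (z :+ x) :+ (:1 :- e) :* (z :+ y)) refl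

  *-distribʳ-cond : ∀ e x y z → cond e x y * z ≈ cond e (x * z) (y * z)
  *-distribʳ-cond = solve 4 (λ e x y z →
    (e :* x :+ (:1 :- e) :* y) :* z := e :* (x :* z) :+ (:1 :- e) :* (y :* z)) refl

  *-distribˡ-cond : ∀ e x y z → z * cond e x y ≈ cond e (z * x) (z * y)
  *-distribˡ-cond = solve 4 (λ e x y z →
    z :* (e :* x :+ (:1 :- e) :* y) := e :* (z :* x) :+ (:1 :- e) :* (z :* y)) refl

  -‿distrib-cond : ∀ e x y → - cond e x y ≈ cond e (- x) (- y)
  -‿distrib-cond = solve 3 (λ e x y →
    :- (e :* x :+ (:1 :- e) :* y) := e :* (:- x) :+ (:1 :- e) :* (:- y)) refl

  cond-expand : ∀ e x y → cond e x y ≈ e * x + (y + e * - y)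
  cond-expand = solve 3 (λ e x y → e :* x :+ (:1 :- e) :* y := e :* x :+ (y :+ e :* :- y)) refl

  complement-idempotent : ∀ {e} → Idempotent e → Idempotent (1# - e)
  complement-idempotent {e} e² = begin
    (1# - e) * (1# - e)     ≈⟨ solve 1 (λ e → (:1 :- e) :* (:1 :- e) := :1 :- e :- e :+ e :* e) refl e ⟩
    1# - e - e + e * e      ≈⟨ +-congˡ e² ⟩
    1# - e - e + e          ≈⟨ solve 1 (λ e → :1 :- e :- e :+ e := :1 :- e) refl e ⟩
    1# - e                  ∎

  idempotent-orthogonal : ∀ {e} → Idempotent e → ∀ x y → (e * x) * ((1# - e) * y) ≈ 0#
  idempotent-orthogonal {e} e² x y = begin
    (e * x) * ((1# - e) * y)  ≈⟨ solve 3 (λ e x y → (e :* x) :* ((:1 :- e) :* y) := (e :- e :* e) :* (x :* y)) refl e x y ⟩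
    (e - e * e) * (x * y)     ≈⟨ *-congʳ (+-congˡ (-‿cong e²)) ⟩
    (e - e) * (x * y)         ≈⟨ solve 2 (λ e z → (e :- e) :* z := :0) refl e (x * y) ⟩
    0#                        ∎

  +-by-cases : ∀ {e f x y} → Idempotent e → Idempotent f → e * x ≈ x → f * y ≈ y →
               cond e (cond f (f * x + e * y) x) y ≈ x + y
  +-by-cases {e} {f} {x} {y} e² f² ex≈x fy≈y = begin
    cond e (cond f (f * x + e * y) x) y
      ≈⟨ solve 4 (λ e f x y →
           e :* (f :* (f :* x :+ e :* y) :+ (:1 :- f) :* x) :+ (:1 :- e) :* y
           := (e :* (f :* f) :* x :- e :* f :* x) :+ ((e :* e) :* (f :* y) :- e :* y) :+ (e :* x :+ y))
           refl e f x y ⟩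
    (e * (f * f) * x - e * f * x) + ((e * e) * (f * y) - e * y) + (e * x + y)
      ≈⟨ +-cong (+-cong (+-congʳ (*-congʳ (*-congˡ f²))) (+-congʳ (*-cong e² fy≈y))) (+-congʳ ex≈x) ⟩
    (e * f * x - e * f * x) + (e * y - e * y) + (x + y)
      ≈⟨ solve 4 (λ e f x y → (e :* f :* x :- e :* f :* x) :+ (e :* y :- e :* y) :+ (x :+ y) := x :+ y) refl e f x y ⟩
    x + y ∎

open import Defs

module _ {X : Set} where

  infix 4 _≈_
  _≈_ : Term X → Term X → Set
  _≈_ = Md⊢_≈_

  Md-isCommutativeRing : IsCommutativeRing _≈_ _⊕_ _⊗_ ⊖_ 𝟎 𝟏
  Md-isCommutativeRing = record
    { isRing = record
      { +-isAbelianGroup = record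
        { isGroup = record
          { isMonoid = record
            { isSemigroup = record
              { isMagma = record
                { isEquivalence = record { refl = refl ; sym = sym ; trans = trans }
                ; ∙-cong = ⊕-cong }
              ; assoc = +-assoc }
            ; identity = (λ x → trans (+-comm 𝟎 x) (+-idʳ x)) , +-idʳ }
          ; inverse = (λ x → trans (+-comm (⊖ x) x) (+-invʳ x)) , +-invʳ
          ; ⁻¹-cong = ⊖-cong }
        ; comm = +-comm }
      ; *-cong = ⊗-cong
      ; *-assoc = ·-assoc
      ; *-identity = ·-idˡ , λ x → trans (·-comm x 𝟏) (·-idˡ x)
      ; distrib = distrib , λ x y z → trans (·-comm (y ⊕ z) x)
                                       (trans (distrib x y z) (⊕-cong (·-comm x y) (·-comm x z))) }
    ; *-comm = ·-comm }

  Md-commutativeRing : CommutativeRing 0ℓ 0ℓ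
  Md-commutativeRing = record { isCommutativeRing = Md-isCommutativeRing }

  open IntegerCoefficients Md-commutativeRing using (solve; _:=_; _:+_; _:*_; :-_; con; Polynomial)
  open Conditional Md-commutativeRing
  open CommutativeRing Md-commutativeRing using (+-identityˡ; *-identityʳ; zeroʳ; ring)
  open import Algebra.Properties.Ring ring using (-0#≈0#; -‿+-comm)
  open import Relation.Binary.Reasoning.Setoid (CommutativeRing.setoid Md-commutativeRing)

  private
    :0 : ∀ {n} → Polynomial n
    :0 = con (+ 0)

  IsPseudoInverse : Term X → Term X → Set
  IsPseudoInverse x y = x ⊗ (x ⊗ y) ≈ x × y ⊗ (y ⊗ x) ≈ y

  ⁻¹-isPseudoInverse : ∀ x → IsPseudoInverse x (x ⁻¹)
  ⁻¹-isPseudoInverse x = ril x , trans (⊗-cong refl (⊗-cong refl (sym (inv-inv x)))) (ril (x ⁻¹))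

  pseudoInverse-absorbs : ∀ {x y z} → y ⊗ (y ⊗ x) ≈ y → x ⊗ (x ⊗ z) ≈ x → y ⊗ (x ⊗ z) ≈ y
  pseudoInverse-absorbs {x} {y} {z} yyx≈y xxz≈x = begin
    y ⊗ (x ⊗ z)              ≈⟨ ⊗-cong yyx≈y refl ⟨
    (y ⊗ (y ⊗ x)) ⊗ (x ⊗ z)  ≈⟨ solve 3 (λ x y z → (y :* (y :* x)) :* (x :* z) := y :* (y :* (x :* (x :* z)))) refl x y z ⟩
    y ⊗ (y ⊗ (x ⊗ (x ⊗ z)))  ≈⟨ ⊗-cong refl (⊗-cong refl xxz≈x) ⟩
    y ⊗ (y ⊗ x)              ≈⟨ yyx≈y ⟩
    y                        ∎

  pseudoInverse-unique : ∀ {x y z} → IsPseudoInverse x y → IsPseudoInverse x z → y ≈ z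
  pseudoInverse-unique {x} {y} {z} (xxy≈x , yyx≈y) (xxz≈x , zzx≈z) = begin
    y            ≈⟨ pseudoInverse-absorbs yyx≈y xxz≈x ⟨
    y ⊗ (x ⊗ z)  ≈⟨ solve 3 (λ x y z → y :* (x :* z) := z :* (x :* y)) refl x y z ⟩
    z ⊗ (x ⊗ y)  ≈⟨ pseudoInverse-absorbs zzx≈z xxy≈x ⟩
    z            ∎

  pseudoInverse⇒⁻¹ : ∀ {x y} → IsPseudoInverse x y → y ≈ x ⁻¹
  pseudoInverse⇒⁻¹ {x} inv = pseudoInverse-unique inv (⁻¹-isPseudoInverse x)

  pseudoInverse-⊗ : ∀ {x x' y y'} → IsPseudoInverse x x' → IsPseudoInverse y y' →
                    IsPseudoInverse (x ⊗ y) (x' ⊗ y')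
  pseudoInverse-⊗ (xxx'≈x , x'x'x≈x') (yyy'≈y , y'y'y≈y') =
    trans (regroup _ _ _ _) (⊗-cong xxx'≈x yyy'≈y) , trans (regroup _ _ _ _) (⊗-cong x'x'x≈x' y'y'y≈y')
    where
    regroup : ∀ a b c d → (a ⊗ b) ⊗ ((a ⊗ b) ⊗ (c ⊗ d)) ≈ (a ⊗ (a ⊗ c)) ⊗ (b ⊗ (b ⊗ d))
    regroup = solve 4 (λ a b c d → (a :* b) :* ((a :* b) :* (c :* d)) := (a :* (a :* c)) :* (b :* (b :* d))) refl

  ⁻¹-distrib-⊗ : ∀ x y → (x ⊗ y) ⁻¹ ≈ x ⁻¹ ⊗ y ⁻¹
  ⁻¹-distrib-⊗ x y = sym (pseudoInverse⇒⁻¹ (pseudoInverse-⊗ (⁻¹-isPseudoInverse x) (⁻¹-isPseudoInverse y)))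

  idempotent⇒⁻¹-fixed : ∀ {e} → Idempotent e → e ⁻¹ ≈ e
  idempotent⇒⁻¹-fixed e² = sym (pseudoInverse⇒⁻¹ (eee≈e , eee≈e))
    where eee≈e = trans (⊗-cong refl e²) e²

  annihilates-pseudoInverse : ∀ {x y y'} → IsPseudoInverse y y' → x ⊗ y ≈ 𝟎 → x ⊗ y' ≈ 𝟎
  annihilates-pseudoInverse {x} {y} {y'} (_ , y'y'y≈y') xy≈0 = begin
    x ⊗ y'                ≈⟨ ⊗-cong refl y'y'y≈y' ⟨
    x ⊗ (y' ⊗ (y' ⊗ y))   ≈⟨ solve 3 (λ x y y' → x :* (y' :* (y' :* y)) := (y' :* y') :* (x :* y)) refl x y y' ⟩
    (y' ⊗ y') ⊗ (x ⊗ y)   ≈⟨ ⊗-cong refl xy≈0 ⟩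
    (y' ⊗ y') ⊗ 𝟎         ≈⟨ solve 1 (λ w → w :* :0 := :0) refl (y' ⊗ y') ⟩
    𝟎                     ∎

  orthogonal-⊕-absorbs : ∀ {x y x' y'} → x ⊗ y ≈ 𝟎 → x ⊗ y' ≈ 𝟎 → y ⊗ x' ≈ 𝟎 →
                         x ⊗ (x ⊗ x') ≈ x → y ⊗ (y ⊗ y') ≈ y → (x ⊕ y) ⊗ ((x ⊕ y) ⊗ (x' ⊕ y')) ≈ x ⊕ y
  orthogonal-⊕-absorbs {x} {y} {x'} {y'} xy≈0 xy'≈0 yx'≈0 xxx'≈x yyy'≈y = begin
    (x ⊕ y) ⊗ ((x ⊕ y) ⊗ (x' ⊕ y'))
      ≈⟨ solve 4 (λ x y x' y' → (x :+ y) :* ((x :+ y) :* (x' :+ y'))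
           := x :* (x :* x') :+ y :* (y :* y') :+ ((x :* y') :* x :+ (y :* x') :* y :+ (x :* y) :* (x' :+ x' :+ y' :+ y')))
           refl x y x' y' ⟩
    x ⊗ (x ⊗ x') ⊕ y ⊗ (y ⊗ y') ⊕ ((x ⊗ y') ⊗ x ⊕ (y ⊗ x') ⊗ y ⊕ (x ⊗ y) ⊗ (x' ⊕ x' ⊕ y' ⊕ y'))
      ≈⟨ ⊕-cong (⊕-cong xxx'≈x yyy'≈y) (⊕-cong (⊕-cong (⊗-cong xy'≈0 refl) (⊗-cong yx'≈0 refl)) (⊗-cong xy≈0 refl)) ⟩
    x ⊕ y ⊕ (𝟎 ⊗ x ⊕ 𝟎 ⊗ y ⊕ 𝟎 ⊗ (x' ⊕ x' ⊕ y' ⊕ y'))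
      ≈⟨ solve 3 (λ x y w → x :+ y :+ (:0 :* x :+ :0 :* y :+ :0 :* w) := x :+ y) refl x y (x' ⊕ x' ⊕ y' ⊕ y') ⟩
    x ⊕ y ∎

  pseudoInverse-⊕ : ∀ {x x' y y'} → x ⊗ y ≈ 𝟎 → IsPseudoInverse x x' → IsPseudoInverse y y' →
                    IsPseudoInverse (x ⊕ y) (x' ⊕ y')
  pseudoInverse-⊕ xy≈0 x-x' y-y' =
    orthogonal-⊕-absorbs xy≈0 xy'≈0 yx'≈0 (proj₁ x-x') (proj₁ y-y') ,
    orthogonal-⊕-absorbs x'y'≈0 (commute yx'≈0) (commute xy'≈0) (proj₂ x-x') (proj₂ y-y')
    where
    commute : ∀ {a b} → a ⊗ b ≈ 𝟎 → b ⊗ a ≈ 𝟎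
    commute = trans (·-comm _ _)
    xy'≈0 = annihilates-pseudoInverse y-y' xy≈0
    yx'≈0 = annihilates-pseudoInverse x-x' (commute xy≈0)
    x'y'≈0 = commute (annihilates-pseudoInverse x-x' (commute xy'≈0))

  ⁻¹-distrib-orthogonal-⊕ : ∀ {x y} → x ⊗ y ≈ 𝟎 → (x ⊕ y) ⁻¹ ≈ x ⁻¹ ⊕ y ⁻¹
  ⁻¹-distrib-orthogonal-⊕ {x} {y} xy≈0 =
    sym (pseudoInverse⇒⁻¹ (pseudoInverse-⊕ xy≈0 (⁻¹-isPseudoInverse x) (⁻¹-isPseudoInverse y)))

  ⁻¹-distrib-cond : ∀ {e} → Idempotent e → ∀ x y → cond e x y ⁻¹ ≈ cond e (x ⁻¹) (y ⁻¹)
  ⁻¹-distrib-cond {e} e² x y = begin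
    (e ⊗ x ⊕ (𝟏 ⊕ ⊖ e) ⊗ y) ⁻¹          ≈⟨ ⁻¹-distrib-orthogonal-⊕ (idempotent-orthogonal e² x y) ⟩
    (e ⊗ x) ⁻¹ ⊕ ((𝟏 ⊕ ⊖ e) ⊗ y) ⁻¹    ≈⟨ ⊕-cong (⁻¹-distrib-⊗ e x) (⁻¹-distrib-⊗ (𝟏 ⊕ ⊖ e) y) ⟩
    e ⁻¹ ⊗ x ⁻¹ ⊕ (𝟏 ⊕ ⊖ e) ⁻¹ ⊗ y ⁻¹  ≈⟨ ⊕-cong (⊗-cong (idempotent⇒⁻¹-fixed e²) refl)
                                                    (⊗-cong (idempotent⇒⁻¹-fixed (complement-idempotent e²)) refl) ⟩
    e ⊗ x ⁻¹ ⊕ (𝟏 ⊕ ⊖ e) ⊗ y ⁻¹        ∎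

  𝟏[_] : Term X → Term X
  𝟏[ r ] = r ⊘ r

  𝟏[]-idempotent : ∀ r → Idempotent 𝟏[ r ]
  𝟏[]-idempotent r = begin
    (r ⊗ r ⁻¹) ⊗ (r ⊗ r ⁻¹)  ≈⟨ solve 2 (λ r r' → (r :* r') :* (r :* r') := (r :* (r :* r')) :* r') refl r (r ⁻¹) ⟩
    (r ⊗ (r ⊗ r ⁻¹)) ⊗ r ⁻¹  ≈⟨ ⊗-cong (ril r) refl ⟩
    r ⊗ r ⁻¹                 ∎

  𝟏[]-absorbs-⊘ : ∀ p q → 𝟏[ q ] ⊗ (p ⊘ q) ≈ p ⊘ q
  𝟏[]-absorbs-⊘ p q = begin
    (q ⊗ q ⁻¹) ⊗ (p ⊗ q ⁻¹)  ≈⟨ solve 3 (λ p q q' → (q :* q') :* (p :* q') := p :* (q' :* (q' :* q))) refl p q (q ⁻¹) ⟩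
    p ⊗ (q ⁻¹ ⊗ (q ⁻¹ ⊗ q))  ≈⟨ ⊗-cong refl (proj₂ (⁻¹-isPseudoInverse q)) ⟩
    p ⊗ q ⁻¹                 ∎

  𝟏[]-⊗-⊘ : ∀ r p q → 𝟏[ r ] ⊗ (p ⊘ q) ≈ (r ⊗ p) ⊘ (r ⊗ q)
  𝟏[]-⊗-⊘ r p q = begin
    (r ⊗ r ⁻¹) ⊗ (p ⊗ q ⁻¹)  ≈⟨ solve 4 (λ r r' p q' → (r :* r') :* (p :* q') := (r :* p) :* (r' :* q')) refl r (r ⁻¹) p (q ⁻¹) ⟩
    (r ⊗ p) ⊗ (r ⁻¹ ⊗ q ⁻¹)  ≈⟨ ⊗-cong refl (⁻¹-distrib-⊗ r q) ⟨
    (r ⊗ p) ⊗ (r ⊗ q) ⁻¹     ∎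

  ⊘-⊗-⊘ : ∀ p q p' q' → (p ⊗ p') ⊘ (q ⊗ q') ≈ (p ⊘ q) ⊗ (p' ⊘ q')
  ⊘-⊗-⊘ p q p' q' = begin
    (p ⊗ p') ⊗ (q ⊗ q') ⁻¹      ≈⟨ ⊗-cong refl (⁻¹-distrib-⊗ q q') ⟩
    (p ⊗ p') ⊗ (q ⁻¹ ⊗ q' ⁻¹)   ≈⟨ solve 4 (λ p p' u u' → (p :* p') :* (u :* u') := (p :* u) :* (p' :* u')) refl p p' (q ⁻¹) (q' ⁻¹) ⟩
    (p ⊗ q ⁻¹) ⊗ (p' ⊗ q' ⁻¹)   ∎

  ⊘-⊕-⊘ : ∀ p q p' q' → (p ⊗ q' ⊕ p' ⊗ q) ⊘ (q ⊗ q') ≈ 𝟏[ q' ] ⊗ (p ⊘ q) ⊕ 𝟏[ q ] ⊗ (p' ⊘ q')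
  ⊘-⊕-⊘ p q p' q' = begin
    (p ⊗ q' ⊕ p' ⊗ q) ⊗ (q ⊗ q') ⁻¹
      ≈⟨ ⊗-cong refl (⁻¹-distrib-⊗ q q') ⟩
    (p ⊗ q' ⊕ p' ⊗ q) ⊗ (q ⁻¹ ⊗ q' ⁻¹)
      ≈⟨ solve 6 (λ p q p' q' u u' → (p :* q' :+ p' :* q) :* (u :* u') := (q' :* u') :* (p :* u) :+ (q :* u) :* (p' :* u'))
           refl p q p' q' (q ⁻¹) (q' ⁻¹) ⟩
    (q' ⊗ q' ⁻¹) ⊗ (p ⊗ q ⁻¹) ⊕ (q ⊗ q ⁻¹) ⊗ (p' ⊗ q' ⁻¹) ∎

  ⊖-⊘ : ∀ p q → (⊖ p) ⊘ q ≈ ⊖ (p ⊘ q)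
  ⊖-⊘ p q = solve 2 (λ p u → (:- p) :* u := :- (p :* u)) refl p (q ⁻¹)

  ⁻¹-⊘ : ∀ p q → (p ⊘ q) ⁻¹ ≈ q ⊘ p
  ⁻¹-⊘ p q = begin
    (p ⊗ q ⁻¹) ⁻¹      ≈⟨ ⁻¹-distrib-⊗ p (q ⁻¹) ⟩
    p ⁻¹ ⊗ q ⁻¹ ⁻¹     ≈⟨ ⊗-cong refl (inv-inv q) ⟩
    p ⁻¹ ⊗ q           ≈⟨ ·-comm _ _ ⟩
    q ⊗ p ⁻¹           ∎

  ⊘-identityʳ : ∀ x → x ⊘ 𝟏 ≈ x
  ⊘-identityʳ x = trans (⊗-cong refl (idempotent⇒⁻¹-fixed (·-idˡ 𝟏))) (*-identityʳ x)

  Poly : Set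
  Poly = Σ (Term X) IsPoly

  infixl 6 _+ₚ_
  infixl 7 _*ₚ_
  _+ₚ_ _*ₚ_ : Poly → Poly → Poly
  (p , p-poly) +ₚ (q , q-poly) = p ⊕ q , p-poly ⊕ q-poly
  (p , p-poly) *ₚ (q , q-poly) = p ⊗ q , p-poly ⊗ q-poly

  -ₚ_ : Poly → Poly
  -ₚ (p , p-poly) = ⊖ p , ⊖ p-poly

  data CondTree : Set where
    leaf : Poly → Poly → CondTree
    node : Poly → CondTree → CondTree → CondTree

  ⟦_⟧ : CondTree → Term X
  ⟦ leaf (p , _) (q , _) ⟧ = p ⊘ q
  ⟦ node (r , _) a b ⟧ = cond 𝟏[ r ] ⟦ a ⟧ ⟦ b ⟧

  mapLeaves : (Poly → Poly → CondTree) → CondTree → CondTree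
  mapLeaves f (leaf p q) = f p q
  mapLeaves f (node r a b) = node r (mapLeaves f a) (mapLeaves f b)

  mapLeaves-sound : ∀ (op : Term X → Term X) f →
                    (∀ r x y → op (cond 𝟏[ r ] x y) ≈ cond 𝟏[ r ] (op x) (op y)) →
                    (∀ p q → ⟦ f p q ⟧ ≈ op ⟦ leaf p q ⟧) →
                    ∀ t → ⟦ mapLeaves f t ⟧ ≈ op ⟦ t ⟧
  mapLeaves-sound op f op-distrib-cond f-sound = sound
    where
    sound : ∀ t → ⟦ mapLeaves f t ⟧ ≈ op ⟦ t ⟧
    sound (leaf p q) = f-sound p q
    sound (node (r , _) a b) =
      trans (cond-cong 𝟏[ r ] (sound a) (sound b)) (sym (op-distrib-cond r ⟦ a ⟧ ⟦ b ⟧))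

  graft : (Poly → Poly → Poly → Poly → CondTree) → CondTree → CondTree → CondTree
  graft f (node r a b) u = node r (graft f a u) (graft f b u)
  graft f (leaf p q) (node r a b) = node r (graft f (leaf p q) a) (graft f (leaf p q) b)
  graft f (leaf p q) (leaf p' q') = f p q p' q'

  graft-sound : ∀ (_∙_ : Term X → Term X → Term X) f →
                (∀ r x y z → cond 𝟏[ r ] x y ∙ z ≈ cond 𝟏[ r ] (x ∙ z) (y ∙ z)) →
                (∀ r x y z → z ∙ cond 𝟏[ r ] x y ≈ cond 𝟏[ r ] (z ∙ x) (z ∙ y)) →
                (∀ p q p' q' → ⟦ f p q p' q' ⟧ ≈ ⟦ leaf p q ⟧ ∙ ⟦ leaf p' q' ⟧) →
                ∀ s t → ⟦ graft f s t ⟧ ≈ ⟦ s ⟧ ∙ ⟦ t ⟧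
  graft-sound _∙_ f ∙-distribʳ-cond ∙-distribˡ-cond f-sound = sound
    where
    sound : ∀ s t → ⟦ graft f s t ⟧ ≈ ⟦ s ⟧ ∙ ⟦ t ⟧
    sound (node (r , _) a b) u =
      trans (cond-cong 𝟏[ r ] (sound a u) (sound b u)) (sym (∙-distribʳ-cond r ⟦ a ⟧ ⟦ b ⟧ ⟦ u ⟧))
    sound (leaf p q) (node (r , _) a b) =
      trans (cond-cong 𝟏[ r ] (sound (leaf p q) a) (sound (leaf p q) b))
            (sym (∙-distribˡ-cond r ⟦ a ⟧ ⟦ b ⟧ ⟦ leaf p q ⟧))
    sound (leaf p q) (leaf p' q') = f-sound p q p' q'

  -ᵗ_ : CondTree → CondTree
  -ᵗ_ = mapLeaves (λ p q → leaf (-ₚ p) q)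

  -ᵗ-sound : ∀ t → ⟦ -ᵗ t ⟧ ≈ ⊖ ⟦ t ⟧
  -ᵗ-sound = mapLeaves-sound ⊖_ _ (λ r → -‿distrib-cond 𝟏[ r ]) (λ (p , _) (q , _) → ⊖-⊘ p q)

  _⁻¹ᵗ : CondTree → CondTree
  _⁻¹ᵗ = mapLeaves (λ p q → leaf q p)

  ⁻¹ᵗ-sound : ∀ t → ⟦ t ⁻¹ᵗ ⟧ ≈ ⟦ t ⟧ ⁻¹
  ⁻¹ᵗ-sound = mapLeaves-sound _⁻¹ _ (λ r → ⁻¹-distrib-cond (𝟏[]-idempotent r))
    (λ (p , _) (q , _) → sym (⁻¹-⊘ p q))

  _*ᵗ_ : CondTree → CondTree → CondTree
  _*ᵗ_ = graft (λ p q p' q' → leaf (p *ₚ p') (q *ₚ q'))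

  *ᵗ-sound : ∀ s t → ⟦ s *ᵗ t ⟧ ≈ ⟦ s ⟧ ⊗ ⟦ t ⟧
  *ᵗ-sound = graft-sound _⊗_ _ (λ r → *-distribʳ-cond 𝟏[ r ]) (λ r → *-distribˡ-cond 𝟏[ r ])
    (λ (p , _) (q , _) (p' , _) (q' , _) → ⊘-⊗-⊘ p q p' q')

  -- p/q + p'/q' = (p q' + p' q)/(q q') holds only where q and q' are both invertible;
  -- where q = 0 (resp. q' = 0) the sum is p'/q' (resp. p/q), since x/0 = 0.
  sumLeaves : Poly → Poly → Poly → Poly → CondTree
  sumLeaves p q p' q' = node q (node q' (leaf (p *ₚ q' +ₚ p' *ₚ q) (q *ₚ q')) (leaf p q)) (leaf p' q')

  sumLeaves-sound : ∀ p q p' q' → ⟦ sumLeaves p q p' q' ⟧ ≈ ⟦ leaf p q ⟧ ⊕ ⟦ leaf p' q' ⟧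
  sumLeaves-sound (p , _) (q , _) (p' , _) (q' , _) = begin
    cond 𝟏[ q ] (cond 𝟏[ q' ] ((p ⊗ q' ⊕ p' ⊗ q) ⊘ (q ⊗ q')) (p ⊘ q)) (p' ⊘ q')
      ≈⟨ cond-cong 𝟏[ q ] (cond-cong 𝟏[ q' ] (⊘-⊕-⊘ p q p' q') refl) refl ⟩
    cond 𝟏[ q ] (cond 𝟏[ q' ] (𝟏[ q' ] ⊗ (p ⊘ q) ⊕ 𝟏[ q ] ⊗ (p' ⊘ q')) (p ⊘ q)) (p' ⊘ q')
      ≈⟨ +-by-cases (𝟏[]-idempotent q) (𝟏[]-idempotent q') (𝟏[]-absorbs-⊘ p q) (𝟏[]-absorbs-⊘ p' q') ⟩
    p ⊘ q ⊕ p' ⊘ q' ∎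

  _+ᵗ_ : CondTree → CondTree → CondTree
  _+ᵗ_ = graft sumLeaves

  +ᵗ-sound : ∀ s t → ⟦ s +ᵗ t ⟧ ≈ ⟦ s ⟧ ⊕ ⟦ t ⟧
  +ᵗ-sound = graft-sound _⊕_ _ (λ r → +-distribʳ-cond 𝟏[ r ]) (λ r → +-distribˡ-cond 𝟏[ r ])
    sumLeaves-sound

  polynomial : (t : Term X) → IsPoly t → CondTree
  polynomial t t-poly = leaf (t , t-poly) (𝟏 , 𝟏)

  toTree : Term X → CondTree
  toTree (var x) = polynomial (var x) (var x)
  toTree 𝟎 = polynomial 𝟎 𝟎
  toTree 𝟏 = polynomial 𝟏 𝟏
  toTree (s ⊕ t) = toTree s +ᵗ toTree t
  toTree (s ⊗ t) = toTree s *ᵗ toTree t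
  toTree (⊖ t) = -ᵗ toTree t
  toTree (t ⁻¹) = toTree t ⁻¹ᵗ

  toTree-sound : ∀ t → t ≈ ⟦ toTree t ⟧
  toTree-sound (var x) = sym (⊘-identityʳ (var x))
  toTree-sound 𝟎 = sym (⊘-identityʳ 𝟎)
  toTree-sound 𝟏 = sym (⊘-identityʳ 𝟏)
  toTree-sound (s ⊕ t) =
    trans (⊕-cong (toTree-sound s) (toTree-sound t)) (sym (+ᵗ-sound (toTree s) (toTree t)))
  toTree-sound (s ⊗ t) =
    trans (⊗-cong (toTree-sound s) (toTree-sound t)) (sym (*ᵗ-sound (toTree s) (toTree t)))
  toTree-sound (⊖ t) = trans (⊖-cong (toTree-sound t)) (sym (-ᵗ-sound (toTree t)))
  toTree-sound (t ⁻¹) = trans (⁻¹-cong (toTree-sound t)) (sym (⁻¹ᵗ-sound (toTree t)))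

  Fraction : Set
  Fraction = Poly × Poly

  value : Fraction → Term X
  value ((p , _) , (q , _)) = p ⊘ q

  Σᶠ : List Fraction → Term X
  Σᶠ [] = 𝟎
  Σᶠ (f ∷ fs) = value f ⊕ Σᶠ fs

  scale : Poly → Fraction → Fraction
  scale r (p , q) = r *ₚ p , r *ₚ q

  negate : Fraction → Fraction
  negate (p , q) = -ₚ p , q

  Σᶠ-++ : ∀ fs gs → Σᶠ (fs ++ gs) ≈ Σᶠ fs ⊕ Σᶠ gs
  Σᶠ-++ [] gs = sym (+-identityˡ _)
  Σᶠ-++ (f ∷ fs) gs = trans (⊕-cong refl (Σᶠ-++ fs gs)) (sym (+-assoc _ _ _))

  Σᶠ-scale : ∀ r fs → Σᶠ (map (scale r) fs) ≈ 𝟏[ proj₁ r ] ⊗ Σᶠ fs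
  Σᶠ-scale r [] = sym (zeroʳ _)
  Σᶠ-scale r@(r₀ , _) (((p , _) , (q , _)) ∷ fs) =
    trans (⊕-cong (sym (𝟏[]-⊗-⊘ r₀ p q)) (Σᶠ-scale r fs)) (sym (distrib _ _ _))

  Σᶠ-negate : ∀ fs → Σᶠ (map negate fs) ≈ ⊖ Σᶠ fs
  Σᶠ-negate [] = sym -0#≈0#
  Σᶠ-negate (((p , _) , (q , _)) ∷ fs) =
    trans (⊕-cong (⊖-⊘ p q) (Σᶠ-negate fs)) (-‿+-comm _ _)

  flatten : CondTree → List Fraction
  flatten (leaf p q) = (p , q) ∷ []
  flatten (node r a b) =
    map (scale r) (flatten a) ++ (flatten b ++ map (scale r) (map negate (flatten b)))

  flatten-sound : ∀ t → ⟦ t ⟧ ≈ Σᶠ (flatten t)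
  flatten-sound (leaf p q) = sym (+-idʳ _)
  flatten-sound (node r@(r₀ , _) a b) = begin
    cond 𝟏[ r₀ ] ⟦ a ⟧ ⟦ b ⟧
      ≈⟨ cond-expand 𝟏[ r₀ ] ⟦ a ⟧ ⟦ b ⟧ ⟩
    𝟏[ r₀ ] ⊗ ⟦ a ⟧ ⊕ (⟦ b ⟧ ⊕ 𝟏[ r₀ ] ⊗ ⊖ ⟦ b ⟧)
      ≈⟨ ⊕-cong (⊗-cong refl (flatten-sound a))
                (⊕-cong (flatten-sound b) (⊗-cong refl (⊖-cong (flatten-sound b)))) ⟩
    𝟏[ r₀ ] ⊗ Σᶠ fa ⊕ (Σᶠ fb ⊕ 𝟏[ r₀ ] ⊗ ⊖ Σᶠ fb)
      ≈⟨ ⊕-cong (Σᶠ-scale r fa)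
                (⊕-cong refl (trans (Σᶠ-scale r (map negate fb)) (⊗-cong refl (Σᶠ-negate fb)))) ⟨
    Σᶠ (map (scale r) fa) ⊕ (Σᶠ fb ⊕ Σᶠ (map (scale r) (map negate fb)))
      ≈⟨ trans (Σᶠ-++ _ _) (⊕-cong refl (Σᶠ-++ _ _)) ⟨
    Σᶠ (flatten (node r a b)) ∎
    where
    fa = flatten a
    fb = flatten b

  terms : List Fraction → List (Term X × Term X)
  terms [] = []
  terms (((p , _) , (q , _)) ∷ fs) = (p , q) ∷ terms fs

  terms-allPoly : ∀ fs → AllPolyPairs (terms fs)
  terms-allPoly [] = []
  terms-allPoly (((_ , p-poly) , (_ , q-poly)) ∷ fs) = (p-poly , q-poly) ∷ terms-allPoly fs

  foldl-terms : ∀ acc fs → foldl (λ acc f → acc ⊕ (proj₁ f ⊘ proj₂ f)) acc (terms fs) ≈ acc ⊕ Σᶠ fs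
  foldl-terms acc [] = sym (+-idʳ _)
  foldl-terms acc (((p , _) , (q , _)) ∷ fs) = trans (foldl-terms (acc ⊕ p ⊘ q) fs) (+-assoc _ _ _)

  sumFracs-terms : ∀ fs → sumFracs (𝟎 , 𝟏) (terms fs) ≈ Σᶠ fs
  sumFracs-terms fs = begin
    sumFracs (𝟎 , 𝟏) (terms fs)  ≈⟨ foldl-terms (𝟎 ⊘ 𝟏) fs ⟩
    𝟎 ⊘ 𝟏 ⊕ Σᶠ fs                ≈⟨ ⊕-cong (⊘-identityʳ 𝟎) refl ⟩
    𝟎 ⊕ Σᶠ fs                    ≈⟨ +-identityˡ _ ⟩
    Σᶠ fs                        ∎

mainTheorem7 : {X : Set} (t : Term X) → Σ (List (Term X × Term X)) λ fs → Σ (Term X × Term X) λ f₀ → AllPolyPairs (f₀ ∷ fs) × (Md⊢ t ≈ sumFracs f₀ fs)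
mainTheorem7 t = terms fs , (𝟎 , 𝟏) , (𝟎 , 𝟏) ∷ terms-allPoly fs , t≈sum
  where
  fs = flatten (toTree t)
  t≈sum = trans (toTree-sound t) (trans (flatten-sound (toTree t)) (sym (sumFracs-terms fs)))
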